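{- Let $\mathcal{F}$ be the family of odd cycles. Then a graph $G$ is a convex geometry in the $\mathcal{F}$-free convexity if and only if $G$ is bipartite.
   Context: Graphs are finite and simple. For a nontrivial graph $H$ and a graph $G$, a set $S\subseteq V(G)$ is $H$-free convex if for every $S'\subseteq S$ with $|S'|=|V(H)|-1$ and every $x\in V(G)$, if the subgraph of $G$ induced by $S'\cup\{x\}$ is isomorphic to $H$, then $x\in S$. For a family $\mathcal{F}$ of nontrivial graphs, $S$ is $\mathcal{F}$-free convex if it is $H$-free convex for every $H\in\mathcal{F}$; these are the convex sets of the $\mathcal{F}$-free convexity. The convex hull $H(S)$ of $S$ is the smallest convex set containing $S$. A vertex $x$ of a convex set $S$ is an extreme vertex of $S$ if $S\setminus\{x\}$ is convex; $\mathit{ext}(S)$ denotes the set of extreme vertices of $S$. $G$ is a convex geometry (with respect to the convexity) if every convex set $S\subseteq V(G)$ satisfies $S=H(\mathit{ext}(S))$. -}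

module Defs where

open import Data.Nat using (ℕ; zero; suc; _+_; _*_; _∸_)
open import Data.Fin using (Fin; toℕ)
open import Data.Fin.Subset using (Subset; _∈_; _─_; ⁅_⁆)
open import Data.Bool using (Bool)
open import Data.Product using (Σ; ∃; _×_)
open import Data.Sum using (_⊎_)
open import Relation.Nullary using (¬_; Dec)
open import Relation.Binary.PropositionalEquality using (_≡_; _≢_)
open import Function.Bundles using (_⇔_)

record Graph : Set₁ where
  field
    n      : ℕ
    Adj    : Fin n → Fin n → Set
    sym    : ∀ {u v} → Adj u v → Adj v u
    irrefl : ∀ {u} → ¬ Adj u u
    dec    : ∀ u v → Dec (Adj u v)

open Graph public

-- Adjacency of the cycle C_m on vertices 0,…,m-1 (i ~ i+1 mod m); used with m ≥ 3.
CycleAdj : (m : ℕ) → Fin m → Fin m → Set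
CycleAdj m i j =
  (toℕ j ≡ suc (toℕ i)) ⊎ (toℕ i ≡ suc (toℕ j))
  ⊎ ((toℕ i ≡ 0 × toℕ j ≡ m ∸ 1) ⊎ (toℕ j ≡ 0 × toℕ i ≡ m ∸ 1))

-- The odd cycle C_{2k+3}; the family F of odd cycles is {C_{2k+3} | k : ℕ}.
oddCycleSize : ℕ → ℕ
oddCycleSize k = suc (suc (suc (2 * k)))

module _ (G : Graph) where

  -- There are S' ⊆ S with |S'| = m - 1 such that G[S' ∪ {x}] ≅ C_m.
  -- Encoded by an injective g : Fin m → V(G) that is an isomorphism of C_m onto
  -- the induced subgraph on its image, with x = g i and g j ∈ S for all j ≠ i
  -- (so S' = g(Fin m) ∖ {x}).
  CycleTriggered : (m : ℕ) → Subset (n G) → Fin (n G) → Set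
  CycleTriggered m S x =
    Σ (Fin m → Fin (n G)) λ g →
      (∀ a b → g a ≡ g b → a ≡ b)
      × (∀ a b → Adj G (g a) (g b) ⇔ CycleAdj m a b)
      × Σ (Fin m) λ i → (g i ≡ x) × (∀ j → j ≢ i → g j ∈ S)

  CycleFreeConvex : ℕ → Subset (n G) → Set
  CycleFreeConvex m S = ∀ x → CycleTriggered m S x → x ∈ S

  Convex : Subset (n G) → Set
  Convex S = ∀ k → CycleFreeConvex (oddCycleSize k) S

  InHull : (Fin (n G) → Set) → Fin (n G) → Set
  InHull P x = ∀ C → Convex C → (∀ y → P y → y ∈ C) → x ∈ C

  Extreme : Subset (n G) → Fin (n G) → Set
  Extreme S x = x ∈ S × Convex (S ─ ⁅ x ⁆)

  ConvexGeometry : Set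
  ConvexGeometry = ∀ S → Convex S → ∀ x → (x ∈ S ⇔ InHull (Extreme S) x)

  Bipartite : Set
  Bipartite = Σ (Fin (n G) → Bool) λ c → ∀ u v → Adj G u v → c u ≢ c v

module Submission where

-- A convex geometry cannot contain an induced odd cycle: the vertices lying on no induced odd cycle
-- form a convex set containing every extreme vertex of V(G), hence the hull of those extreme vertices,
-- which is all of V(G).  Conversely, a graph without induced odd cycles has no closed walk of odd
-- length either, since a shortest one would be an induced odd cycle; colouring each vertex by the
-- parity of its walks to a fixed vertex of its component then 2-colours G.  In a bipartite graph no
-- odd cycle occurs at all, so every set is convex and every vertex is extreme.
-- The classical steps are carried out under double negation, which bipartiteness, being decidable,
-- can be recovered from.

open import Level using (Level)
open import Data.Bool.Base using (Bool; not)
open import Data.Bool.Properties using (not-¬; ¬-not; not-involutive) renaming (_≟_ to _≟ᵇ_)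
open import Data.Empty using (⊥-elim)
open import Data.Fin.Base using (Fin; toℕ; fromℕ<; inject; punchIn)
import Data.Fin.Base as Fin
open import Data.Fin.Properties
  using (toℕ<n; toℕ-injective; toℕ-fromℕ<; toℕ-inject; punchInᵢ≢i; ∀-cons; ¬∀⟶∃¬-smallest; all?)
import Data.Fin.Properties as Finₚ
open import Data.Fin.Subset using (Subset; _∈_; _∉_; _-_; ⊤)
open import Data.Fin.Subset.Properties using (∈⊤; x∈p∧x≢y⇒x∈p-y; anySubset?)
open import Data.Nat.Base using (ℕ; zero; suc; _+_; _*_; _∸_; _≤_; _<_; s≤s; z<s; s<s; parity)
open import Data.Nat.GeneralisedArithmetic using (fold)
open import Data.Nat.Induction using (<-wellFounded)
open import Data.Nat.Properties
open import Data.Nat.Tactic.RingSolver using (solve-∀)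
open import Data.Parity.Base using (Parity; 0ℙ; 1ℙ; _⁻¹)
import Data.Parity.Base as ℙ
import Data.Parity.Properties as ℙₚ
open import Data.Product using (Σ; ∃; _×_; _,_; proj₁; proj₂)
open import Data.Sum using (_⊎_; inj₁; inj₂)
open import Data.Vec.Base using (_∷_; tabulate; lookup; there)
open import Data.Vec.Properties using (lookup∘tabulate; lookup⇒[]=; []=⇒lookup)
open import Function.Base using (_∘_; case_of_)
open import Function.Bundles using (_⇔_; mk⇔; Equivalence)
open import Induction.WellFounded using (Acc; acc)
open import Relation.Binary.Definitions using (tri<; tri≈; tri>)
open import Relation.Binary.PropositionalEquality using (_≡_; _≢_; refl; trans; cong; subst; subst₂)
import Relation.Binary.PropositionalEquality as ≡
open import Relation.Nullary using (¬_; Dec; yes; no; does)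
open import Relation.Nullary.Decidable
  using (decidable-stable; does-⇔; dec-true; map′; ¬?; ¬¬-excluded-middle; _→-dec_)
open import Relation.Unary using (Pred; Decidable)

open import Defs hiding (sym)

private
  variable
    ℓ : Level

¬¬-Π-Fin : ∀ {k} {P : Fin k → Set ℓ} → (∀ i → ¬ ¬ P i) → ¬ ¬ (∀ i → P i)
¬¬-Π-Fin {k = zero}  _   ¬∀ = ¬∀ λ ()
¬¬-Π-Fin {k = suc k} ¬¬P ¬∀ = ¬¬P Fin.zero λ P₀ → ¬¬-Π-Fin (¬¬P ∘ Fin.suc) (¬∀ ∘ ∀-cons P₀)

¬¬-decidable : ∀ {k} (P : Pred (Fin k) ℓ) → ¬ ¬ Decidable P
¬¬-decidable P = ¬¬-Π-Fin λ _ → ¬¬-excluded-middle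

¬¬-decidable₂ : ∀ {k k′} (R : Fin k → Fin k′ → Set ℓ) → ¬ ¬ (∀ x y → Dec (R x y))
¬¬-decidable₂ R = ¬¬-Π-Fin λ x → ¬¬-decidable (R x)

toSubset : ∀ {k} {P : Pred (Fin k) ℓ} → Decidable P → Subset k
toSubset P? = tabulate (does ∘ P?)

module _ {k} {P : Pred (Fin k) ℓ} (P? : Decidable P) where

  ∈-toSubset⁺ : ∀ {x} → P x → x ∈ toSubset P?
  ∈-toSubset⁺ {x} px = lookup⇒[]= x _ (trans (lookup∘tabulate _ x) (dec-true (P? x) px))

  ∈-toSubset⁻ : ∀ {x} → x ∈ toSubset P? → P x
  ∈-toSubset⁻ {x} x∈ with P? x | trans (≡.sym (lookup∘tabulate (does ∘ P?) x)) ([]=⇒lookup x∈)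
  ... | yes px | _  = px
  ... | no _   | ()

x∉p-x : ∀ {k} (p : Subset k) (x : Fin k) → x ∉ p - x
x∉p-x (_ ∷ p) Fin.zero    ()
x∉p-x (_ ∷ p) (Fin.suc x) (there x∈) = x∉p-x p x x∈

Least : ∀ {k} → Pred (Fin k) ℓ → Pred (Fin k) ℓ
Least P i = P i × (∀ {j} → j Fin.< i → ¬ P j)

least : ∀ {k} {P : Pred (Fin k) ℓ} → Decidable P → ∃ P → ∃ (Least P)
least {k = k} {P = P} P? (x , px) with ¬∀⟶∃¬-smallest k (¬_ ∘ P) (¬? ∘ P?) (λ ¬P → ¬P x px)
... | i , ¬¬Pi , below =
  i , decidable-stable (P? i) ¬¬Pi ,
  λ j<i Pj → below (fromℕ< j<i) (subst P (≡.sym (inject-fromℕ< j<i)) Pj)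
  where
  inject-fromℕ< : ∀ {j} (j<i : j Fin.< i) → inject (fromℕ< j<i) ≡ j
  inject-fromℕ< j<i = toℕ-injective (trans (toℕ-inject (fromℕ< j<i)) (toℕ-fromℕ< j<i))

least-unique : ∀ {k} {P Q : Pred (Fin k) ℓ} {i j} → (∀ x → P x ⇔ Q x) → Least P i → Least Q j → i ≡ j
least-unique {i = i} {j} P⇔Q (Pi , P-below) (Qj , Q-below) with Finₚ.<-cmp i j
... | tri< i<j _ _ = ⊥-elim (Q-below i<j (Equivalence.to (P⇔Q i) Pi))
... | tri≈ _ i≡j _ = i≡j
... | tri> _ _ j<i = ⊥-elim (P-below j<i (Equivalence.from (P⇔Q j) Qj))

∃-gap : ∀ {i j} → i < j → ∃ λ a → suc a + i ≡ j
∃-gap {i} {j} i<j = j ∸ suc i , trans (≡.sym (+-suc (j ∸ suc i) i)) (m∸n+n≡m i<j)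

∸-suc : ∀ {t m} → t < m → m ∸ t ≡ suc (m ∸ suc t)
∸-suc = +-∸-assoc 1

parity-+-double : ∀ a b → parity (a + (b + b)) ≡ parity a
parity-+-double a b = begin
  parity (a + (b + b))                  ≡⟨ ℙₚ.+-homo-+ a (b + b) ⟩
  parity a ℙ.+ parity (b + b)           ≡⟨ cong (parity a ℙ.+_) (ℙₚ.+-homo-+ b b) ⟩
  parity a ℙ.+ (parity b ℙ.+ parity b)  ≡⟨ cong (parity a ℙ.+_) (ℙₚ.p+p≡0ℙ (parity b)) ⟩
  parity a ℙ.+ 0ℙ                       ≡⟨ ℙₚ.+-identityʳ (parity a) ⟩
  parity a                              ∎
  where open ≡.≡-Reasoning

odd-+ : ∀ a b → parity (a + b) ≡ 1ℙ → parity a ≡ 1ℙ ⊎ parity b ≡ 1ℙ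
odd-+ a b odd with parity a | ℙₚ.+-homo-+ a b
... | 1ℙ | _  = inj₁ refl
... | 0ℙ | eq = inj₂ (trans (≡.sym eq) odd)

odd⇒oddCycleSize : ∀ m → parity m ≡ 1ℙ → m ≢ 1 → ∃ λ k → oddCycleSize k ≡ m
odd⇒oddCycleSize 1 _ m≢1 = ⊥-elim (m≢1 refl)
odd⇒oddCycleSize 3 _ _   = 0 , refl
odd⇒oddCycleSize (suc (suc m@(suc (suc _)))) odd _ with odd⇒oddCycleSize m odd (λ ())
... | k , eq = suc k , trans (cong (3 +_) (*-suc 2 k)) (cong (2 +_) eq)

fold-not-double : ∀ b k → fold b not (2 * k) ≡ b
fold-not-double b zero    = refl
fold-not-double b (suc k) = begin
  fold b not (2 * suc k)          ≡⟨ cong (fold b not) (*-suc 2 k) ⟩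
  not (not (fold b not (2 * k)))  ≡⟨ not-involutive _ ⟩
  fold b not (2 * k)              ≡⟨ fold-not-double b k ⟩
  b                               ∎
  where open ≡.≡-Reasoning

module _ (G : Graph) where

  private
    V : Set
    V = Fin (n G)

    _∼_ : V → V → Set
    _∼_ = Adj G

    ∼-sym : ∀ {u v} → u ∼ v → v ∼ u
    ∼-sym = Graph.sym G

    ∼-irrefl : ∀ {v} → ¬ v ∼ v
    ∼-irrefl = Graph.irrefl G

    variable
      u v x : V
      p : Parity

  -- Positions beyond len are unconstrained.
  record Walk (u v : V) : Set where
    field
      len   : ℕ
      at    : ℕ → V
      start : at 0 ≡ u
      end   : at len ≡ v
      step  : ∀ {t} → t < len → at t ∼ at (suc t)

  open Walk

  castWalk : ∀ {u′ v′} → u ≡ u′ → v ≡ v′ → Walk u v → Walk u′ v′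
  castWalk u≡u′ v≡v′ w = record
    { len = len w ; at = at w ; start = trans (start w) u≡u′ ; end = trans (end w) v≡v′ ; step = step w }

  stay : (v : V) → Walk v v
  stay v = record { len = 0 ; at = λ _ → v ; start = refl ; end = refl ; step = λ () }

  edge : u ∼ v → Walk u v
  edge {u} {v} e = record
    { len   = 1
    ; at    = λ { zero → u ; (suc _) → v }
    ; start = refl
    ; end   = refl
    ; step  = λ { {zero} _ → e ; {suc _} (s≤s ()) }
    }

  segment : (w : Walk u v) (i k : ℕ) → k + i ≤ len w → Walk (at w i) (at w (k + i))
  segment w i k k+i≤len = record
    { len   = k
    ; at    = λ t → at w (t + i)
    ; start = refl
    ; end   = refl
    ; step  = λ t<k → step w (≤-trans (+-monoˡ-< i t<k) k+i≤len)
    }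

  prefix : (w : Walk u v) (i : ℕ) → i ≤ len w → Walk u (at w i)
  prefix w i i≤len = castWalk (start w) (cong (at w) (+-identityʳ i))
    (segment w 0 i (subst (_≤ len w) (≡.sym (+-identityʳ i)) i≤len))

  suffix : (w : Walk u v) (j k : ℕ) → k + j ≡ len w → Walk (at w j) v
  suffix w j k k+j≡len = castWalk refl (trans (cong (at w) k+j≡len) (end w))
    (segment w j k (≤-reflexive k+j≡len))

  private
    join : ℕ → (ℕ → V) → (ℕ → V) → ℕ → V
    join zero    f g t       = g t
    join (suc l) f g zero    = f zero
    join (suc l) f g (suc t) = join l (f ∘ suc) g t

    join-start : ∀ l f g → f l ≡ g 0 → join l f g 0 ≡ f 0
    join-start zero    f g fl≡g0 = ≡.sym fl≡g0
    join-start (suc l) f g fl≡g0 = refl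

    join-end : ∀ l f g t → join l f g (l + t) ≡ g t
    join-end zero    f g t = refl
    join-end (suc l) f g t = join-end l (f ∘ suc) g t

    join-step : ∀ l k f g → (∀ {t} → t < l → f t ∼ f (suc t)) → f l ≡ g 0 →
                (∀ {t} → t < k → g t ∼ g (suc t)) →
                ∀ {t} → t < l + k → join l f g t ∼ join l f g (suc t)
    join-step zero    k f g _    _     g-step t<k = g-step t<k
    join-step (suc l) k f g f-step fl≡g0 _ {zero} _ =
      subst (f 0 ∼_) (≡.sym (join-start l (f ∘ suc) g fl≡g0)) (f-step z<s)
    join-step (suc l) k f g f-step fl≡g0 g-step {suc t} (s≤s t<l+k) =
      join-step l k (f ∘ suc) g (f-step ∘ s≤s) fl≡g0 g-step t<l+k

  _++_ : Walk u v → Walk v x → Walk u x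
  w ++ w′ = record
    { len   = len w + len w′
    ; at    = join (len w) (at w) (at w′)
    ; start = trans (join-start (len w) (at w) (at w′) meet) (start w)
    ; end   = trans (join-end (len w) (at w) (at w′) (len w′)) (end w′)
    ; step  = join-step (len w) (len w′) (at w) (at w′) (step w) meet (step w′)
    }
    where
    meet : at w (len w) ≡ at w′ 0
    meet = trans (end w) (≡.sym (start w′))

  reverse : Walk u v → Walk v u
  reverse w = record
    { len   = len w
    ; at    = λ t → at w (len w ∸ t)
    ; start = end w
    ; end   = trans (cong (at w) (n∸n≡0 (len w))) (start w)
    ; step  = λ {t} t<len → subst (_∼ at w (len w ∸ suc t)) (cong (at w) (≡.sym (∸-suc t<len)))
                (∼-sym (step w (subst (_≤ len w) (∸-suc t<len) (m∸n≤m (len w) t))))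
    }

  OddClosedWalk : Set
  OddClosedWalk = Σ V λ v → Σ (Walk v v) λ w → parity (len w) ≡ 1ℙ

  length : OddClosedWalk → ℕ
  length (_ , w , _) = len w

  -- The bypass replaces the a steps of w from position i, after which w has b steps left; splitting a
  -- closed w along it yields two closed walks, both shorter than w.
  record Shortcut (w : Walk u v) : Set where
    field
      i a b      : ℕ
      split      : b + (a + i) ≡ len w
      bypass     : Walk (at w i) (at w (a + i))
      bypass<a   : len bypass < a
      bypass<i+b : len bypass < i + b

  module _ (w : Walk v v) (odd : parity (len w) ≡ 1ℙ) (shortcut : Shortcut w) where
    open Shortcut shortcut

    private
      a+i≤len : a + i ≤ len w
      a+i≤len = subst (a + i ≤_) split (m≤n+m (a + i) b)

      arc : Walk (at w i) (at w i)
      arc = segment w i a a+i≤len ++ reverse bypass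

      rest : Walk v v
      rest = prefix w i (≤-trans (m≤n+m i a) a+i≤len) ++ (bypass ++ suffix w (a + i) b split)

      arc<w : len arc < len w
      arc<w = begin-strict
        a + len bypass  <⟨ +-monoʳ-< a bypass<i+b ⟩
        a + (i + b)     ≡⟨ ≡.sym (+-assoc a i b) ⟩
        a + i + b       ≡⟨ +-comm (a + i) b ⟩
        b + (a + i)     ≡⟨ split ⟩
        len w           ∎
        where open ≤-Reasoning

      rest<w : len rest < len w
      rest<w = begin-strict
        i + (len bypass + b)  <⟨ +-monoʳ-< i (+-monoˡ-< b bypass<a) ⟩
        i + (a + b)           ≡⟨ rearrange i a b ⟩
        b + (a + i)           ≡⟨ split ⟩
        len w                 ∎
        where
        open ≤-Reasoning
        rearrange : ∀ i a b → i + (a + b) ≡ b + (a + i)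
        rearrange = solve-∀

      split-parity : parity (len arc + len rest) ≡ 1ℙ
      split-parity = begin
        parity ((a + l) + (i + (l + b)))  ≡⟨ cong parity (rearrange i a b l) ⟩
        parity (b + (a + i) + (l + l))    ≡⟨ parity-+-double (b + (a + i)) l ⟩
        parity (b + (a + i))              ≡⟨ cong parity split ⟩
        parity (len w)                    ≡⟨ odd ⟩
        1ℙ                                ∎
        where
        open ≡.≡-Reasoning
        l = len bypass
        rearrange : ∀ i a b l → (a + l) + (i + (l + b)) ≡ b + (a + i) + (l + l)
        rearrange = solve-∀

    shorten : Σ OddClosedWalk λ c → length c < len w
    shorten with odd-+ (len arc) (len rest) split-parity
    ... | inj₁ arc-odd  = (_ , arc , arc-odd) , arc<w
    ... | inj₂ rest-odd = (_ , rest , rest-odd) , rest<w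

  IsInducedCycle : (m : ℕ) → (Fin m → V) → Set
  IsInducedCycle m g = (∀ a b → g a ≡ g b → a ≡ b) × (∀ a b → g a ∼ g b ⇔ CycleAdj m a b)

  InducedOddCycle : Set
  InducedOddCycle = Σ ℕ λ k → Σ (Fin (oddCycleSize k) → V) (IsInducedCycle (oddCycleSize k))

  closed-len≢1 : (w : Walk v v) → len w ≢ 1
  closed-len≢1 w len≡1 = ∼-irrefl (subst (at w 0 ∼_) at1≡at0 (step w (subst (0 <_) (≡.sym len≡1) z<s)))
    where
    at1≡at0 : at w 1 ≡ at w 0
    at1≡at0 = trans (cong (at w) (≡.sym len≡1)) (trans (end w) (≡.sym (start w)))

  closing-step : (w : Walk v v) → 0 < len w → at w (len w ∸ 1) ∼ at w 0
  closing-step w 0<len =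
    subst (at w (len w ∸ 1) ∼_) last≡first (step w (≤-reflexive (≡.sym (∸-suc 0<len))))
    where
    last≡first : at w (suc (len w ∸ 1)) ≡ at w 0
    last≡first = trans (cong (at w) (≡.sym (∸-suc 0<len))) (trans (end w) (≡.sym (start w)))

  module _ (w : Walk v v) (shortcut-free : ¬ Shortcut w) where

    private
      0<i+suc-b : ∀ i b → 0 < i + suc b
      0<i+suc-b i b = <-≤-trans z<s (m≤n+m (suc b) i)

      distinct : ∀ {i j} → i < j → j < len w → at w i ≢ at w j
      distinct {i} i<j j<len eq with ∃-gap i<j | ∃-gap j<len
      ... | a , refl | b , split = shortcut-free record
        { i = i ; a = suc a ; b = suc b ; split = split ; bypass = castWalk refl eq (stay (at w i))
        ; bypass<a = z<s ; bypass<i+b = 0<i+suc-b i b }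

      chord : ∀ i a b → suc b + (suc (suc a) + i) ≡ len w → at w i ∼ at w (suc (suc a) + i) →
              1 < i + suc b → Shortcut w
      chord i a b split e 1<i+b = record
        { i = i ; a = suc (suc a) ; b = suc b ; split = split ; bypass = edge e
        ; bypass<a = s<s z<s ; bypass<i+b = 1<i+b }

      chord-gap : ∀ i a b → suc b + (suc a + i) ≡ len w → at w i ∼ at w (suc a + i) →
                  a ≡ 0 ⊎ (i ≡ 0 × b ≡ 0)
      chord-gap i       zero    b       _     _ = inj₁ refl
      chord-gap zero    (suc a) zero    _     _ = inj₂ (refl , refl)
      chord-gap zero    (suc a) (suc b) split e =
        ⊥-elim (shortcut-free (chord zero a (suc b) split e (s<s z<s)))
      chord-gap (suc i) (suc a) b       split e =
        ⊥-elim (shortcut-free (chord (suc i) a b split e (s<s (0<i+suc-b i b))))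

      chord-free : ∀ {i j} → i < j → j < len w → at w i ∼ at w j → j ≡ suc i ⊎ (i ≡ 0 × suc j ≡ len w)
      chord-free {i} i<j j<len e with ∃-gap i<j | ∃-gap j<len
      ... | a , refl | b , split with chord-gap i a b split e
      ...   | inj₁ refl          = inj₁ refl
      ...   | inj₂ (refl , refl) = inj₂ (refl , split)

      injective : ∀ x y → at w (toℕ x) ≡ at w (toℕ y) → x ≡ y
      injective x y eq with <-cmp (toℕ x) (toℕ y)
      ... | tri< x<y _ _ = ⊥-elim (distinct x<y (toℕ<n y) eq)
      ... | tri≈ _ x≡y _ = toℕ-injective x≡y
      ... | tri> _ _ y<x = ⊥-elim (distinct y<x (toℕ<n x) (≡.sym eq))

      adjacent⇒cycleAdj : ∀ x y → at w (toℕ x) ∼ at w (toℕ y) → CycleAdj (len w) x y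
      adjacent⇒cycleAdj x y e with <-cmp (toℕ x) (toℕ y)
      ... | tri< x<y _ _ with chord-free x<y (toℕ<n y) e
      ...   | inj₁ y≡1+x          = inj₁ y≡1+x
      ...   | inj₂ (x≡0 , 1+y≡len) = inj₂ (inj₂ (inj₁ (x≡0 , cong (_∸ 1) 1+y≡len)))
      adjacent⇒cycleAdj x y e | tri≈ _ x≡y _ =
        ⊥-elim (∼-irrefl (subst (λ t → at w (toℕ x) ∼ at w t) (≡.sym x≡y) e))
      adjacent⇒cycleAdj x y e | tri> _ _ y<x with chord-free y<x (toℕ<n x) (∼-sym e)
      ...   | inj₁ x≡1+y          = inj₂ (inj₁ x≡1+y)
      ...   | inj₂ (y≡0 , 1+x≡len) = inj₂ (inj₂ (inj₂ (y≡0 , cong (_∸ 1) 1+x≡len)))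

      cycleAdj⇒adjacent : ∀ x y → CycleAdj (len w) x y → at w (toℕ x) ∼ at w (toℕ y)
      cycleAdj⇒adjacent x y (inj₁ y≡1+x) =
        subst (at w (toℕ x) ∼_) (cong (at w) (≡.sym y≡1+x)) (step w (toℕ<n x))
      cycleAdj⇒adjacent x y (inj₂ (inj₁ x≡1+y)) =
        ∼-sym (subst (at w (toℕ y) ∼_) (cong (at w) (≡.sym x≡1+y)) (step w (toℕ<n y)))
      cycleAdj⇒adjacent x y (inj₂ (inj₂ (inj₁ (x≡0 , y≡last)))) =
        subst₂ (λ s t → at w s ∼ at w t) (≡.sym x≡0) (≡.sym y≡last)
          (∼-sym (closing-step w (m<n⇒0<n (toℕ<n x))))
      cycleAdj⇒adjacent x y (inj₂ (inj₂ (inj₂ (y≡0 , x≡last)))) =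
        subst₂ (λ s t → at w s ∼ at w t) (≡.sym x≡last) (≡.sym y≡0) (closing-step w (m<n⇒0<n (toℕ<n x)))

    shortcutFree⇒inducedCycle : IsInducedCycle (len w) (at w ∘ toℕ)
    shortcutFree⇒inducedCycle = injective , λ x y → mk⇔ (adjacent⇒cycleAdj x y) (cycleAdj⇒adjacent x y)

    shortcutFree⇒inducedOddCycle : parity (len w) ≡ 1ℙ → InducedOddCycle
    shortcutFree⇒inducedOddCycle odd with odd⇒oddCycleSize (len w) odd (closed-len≢1 w)
    ... | k , eq =
      k , subst (λ m → Σ (Fin m → V) (IsInducedCycle m)) (≡.sym eq) (at w ∘ toℕ , shortcutFree⇒inducedCycle)

  oddClosedWalk⇒inducedOddCycle : OddClosedWalk → ¬ ¬ InducedOddCycle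
  oddClosedWalk⇒inducedOddCycle c = shortest c (<-wellFounded (length c))
    where
    shortest : (c : OddClosedWalk) → Acc _<_ (length c) → ¬ ¬ InducedOddCycle
    shortest (_ , w , odd) (acc smaller) noCycle = ¬¬-excluded-middle λ
      { (yes shortcut) → let c′ , c′<w = shorten w odd shortcut in shortest c′ (smaller c′<w) noCycle
      ; (no ¬shortcut) → noCycle (shortcutFree⇒inducedOddCycle w ¬shortcut odd)
      }

  Reach : Parity → V → V → Set
  Reach p u v = Σ (Walk u v) λ w → parity (len w) ≡ p

  Connected : V → V → Set
  Connected u v = ∃ λ p → Reach p u v

  reach-cons : u ∼ x → Reach p x v → Reach (p ⁻¹) u v
  reach-cons e (w , refl) = edge e ++ w , ℙₚ.+-homo-+ 1 (len w)

  reach-clash : Reach p u v → Reach (p ⁻¹) u v → OddClosedWalk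
  reach-clash {u = u} (w , refl) (w′ , p⁻¹) = u , w ++ reverse w′ , (begin
    parity (len w + len w′)               ≡⟨ ℙₚ.+-homo-+ (len w) (len w′) ⟩
    parity (len w) ℙ.+ parity (len w′)    ≡⟨ cong (parity (len w) ℙ.+_) p⁻¹ ⟩
    parity (len w) ℙ.+ parity (len w) ⁻¹  ≡⟨ ℙₚ.p+p⁻¹≡1ℙ (parity (len w)) ⟩
    1ℙ                                    ∎)
    where open ≡.≡-Reasoning

  module _ (no-odd : ¬ OddClosedWalk) (connected? : ∀ u v → Dec (Connected u v))
           (odd? : ∀ u v → Dec (Reach 1ℙ u v)) where

    private
      connected-adjacent : u ∼ v → Connected v x → Connected u x
      connected-adjacent e (p , reach) = p ⁻¹ , reach-cons e reach

      root : V → V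
      root v = proj₁ (least (connected? v) (v , 0ℙ , stay v , refl))

      root-least : ∀ v → Least (Connected v) (root v)
      root-least v = proj₂ (least (connected? v) (v , 0ℙ , stay v , refl))

      root-adjacent : u ∼ v → root u ≡ root v
      root-adjacent e = least-unique (λ r → mk⇔ (connected-adjacent (∼-sym e)) (connected-adjacent e))
        (root-least _) (root-least _)

      odd-alternates : u ∼ v → Connected v x → Reach 1ℙ u x ⇔ (¬ Reach 1ℙ v x)
      odd-alternates e conn = mk⇔
        (λ odd-u odd-v → no-odd (reach-clash odd-v (reach-cons (∼-sym e) odd-u)))
        (λ ¬odd-v → case conn of λ
          { (0ℙ , even-v) → reach-cons e even-v
          ; (1ℙ , odd-v)  → ⊥-elim (¬odd-v odd-v)
          })

      colour : V → Bool
      colour v = does (odd? v (root v))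

      proper : ∀ u v → u ∼ v → colour u ≢ colour v
      proper u v e = subst (λ r → does (odd? u r) ≢ colour v) (≡.sym (root-adjacent e)) opposite
        where
        opposite : does (odd? u (root v)) ≢ colour v
        opposite same = not-¬ refl (trans (≡.sym same)
          (does-⇔ (odd-alternates e (proj₁ (root-least v))) (odd? u (root v)) (¬? (odd? v (root v)))))

    parityColouring : Bipartite G
    parityColouring = colour , proper

  bipartite? : Dec (Bipartite G)
  bipartite? = map′ (λ (c , proper) → lookup c , proper) from
    (anySubset? λ c → all? λ u → all? λ v → Graph.dec G u v →-dec ¬? (lookup c u ≟ᵇ lookup c v))
    where
    from : Bipartite G → ∃ λ (c : Subset (n G)) → ∀ u v → u ∼ v → lookup c u ≢ lookup c v
    from (c , proper) = tabulate c , λ u v e same →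
      proper u v e (trans (≡.sym (lookup∘tabulate c u)) (trans same (lookup∘tabulate c v)))

  noOddClosedWalk⇒bipartite : ¬ OddClosedWalk → Bipartite G
  noOddClosedWalk⇒bipartite no-odd = decidable-stable bipartite? λ ¬bipartite →
    ¬¬-decidable₂ Connected λ connected? →
    ¬¬-decidable₂ (Reach 1ℙ) λ odd? →
    ¬bipartite (parityColouring no-odd connected? odd?)

  OnInducedOddCycle : V → Set
  OnInducedOddCycle x =
    Σ ℕ λ k → Σ (Fin (oddCycleSize k) → V) λ g → IsInducedCycle (oddCycleSize k) g × ∃ λ a → g a ≡ x

  ⊤-convex : Convex G ⊤
  ⊤-convex _ _ _ = ∈⊤

  offInducedOddCycles⇒convex : ∀ {S} → (∀ {x} → x ∈ S → ¬ OnInducedOddCycle x) → Convex G S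
  offInducedOddCycles⇒convex off k x (g , injective , induced , i , _ , others) =
    ⊥-elim (off (others j j≢i) (k , g , (injective , induced) , j , refl))
    where
    j = punchIn i Fin.zero
    j≢i = punchInᵢ≢i i Fin.zero

  onInducedOddCycle⇒¬extreme : OnInducedOddCycle x → ¬ Extreme G ⊤ x
  onInducedOddCycle⇒¬extreme {x} (k , g , (injective , induced) , a , ga≡x) (_ , ⊤-x-convex) =
    x∉p-x ⊤ x (⊤-x-convex k x (g , injective , induced , a , ga≡x , others))
    where
    others : ∀ j → j ≢ a → g j ∈ ⊤ - x
    others j j≢a = x∈p∧x≢y⇒x∈p-y ∈⊤ λ gj≡x → j≢a (injective j a (trans gj≡x (≡.sym ga≡x)))

  convexGeometry⇒noInducedOddCycle : ConvexGeometry G → ¬ InducedOddCycle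
  convexGeometry⇒noInducedOddCycle geometry (k , g , induced) =
    ¬¬-decidable OnInducedOddCycle λ onCycle? →
    let off? = ¬? ∘ onCycle?
        off-convex = offInducedOddCycles⇒convex (∈-toSubset⁻ off?)
        extreme⇒off = λ y extreme → ∈-toSubset⁺ off? λ on → onInducedOddCycle⇒¬extreme on extreme
        g₀-off = Equivalence.to (geometry ⊤ ⊤-convex (g Fin.zero)) ∈⊤ (toSubset off?) off-convex extreme⇒off
    in ∈-toSubset⁻ off? g₀-off (k , g , induced , Fin.zero , refl)

  bipartite⇒noOddCycleImage : Bipartite G → ∀ k (g : Fin (oddCycleSize k) → V) →
                              ¬ (∀ a b → CycleAdj (oddCycleSize k) a b → g a ∼ g b)
  bipartite⇒noOddCycleImage (c , proper) k g hom = proper _ _ (hom last Fin.zero closing)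
    (trans (alternating _ last<m) (trans (not-involutive _) (fold-not-double _ k)))
    where
    m = oddCycleSize k
    last<m : suc (suc (2 * k)) < m
    last<m = n<1+n _
    last = fromℕ< last<m
    closing : CycleAdj m last Fin.zero
    closing = inj₂ (inj₂ (inj₂ (refl , toℕ-fromℕ< last<m)))
    alternating : ∀ t (t<m : t < m) → c (g (fromℕ< t<m)) ≡ fold (c (g Fin.zero)) not t
    alternating zero    _     = refl
    alternating (suc t) 1+t<m = trans (¬-not (proper _ _ (hom _ _ (inj₂ (inj₁ consecutive)))))
                                      (cong not (alternating t t<m))
      where
      t<m = <-trans (n<1+n t) 1+t<m
      consecutive : toℕ (fromℕ< 1+t<m) ≡ suc (toℕ (fromℕ< t<m))
      consecutive = trans (toℕ-fromℕ< 1+t<m) (cong suc (≡.sym (toℕ-fromℕ< t<m)))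

  bipartite⇒convex : Bipartite G → ∀ S → Convex G S
  bipartite⇒convex bipartite S k x (g , _ , induced , _) =
    ⊥-elim (bipartite⇒noOddCycleImage bipartite k g λ a b → Equivalence.from (induced a b))

  bipartite⇒convexGeometry : Bipartite G → ConvexGeometry G
  bipartite⇒convexGeometry bipartite S S-convex x = mk⇔
    (λ x∈S C _ extreme⊆C → extreme⊆C x (x∈S , bipartite⇒convex bipartite _))
    (λ x∈hull → x∈hull S S-convex λ _ → proj₁)

mainTheorem4 : (G : Graph) → ConvexGeometry G ⇔ Bipartite G
mainTheorem4 G = mk⇔
  (λ geometry → noOddClosedWalk⇒bipartite G λ c →
    oddClosedWalk⇒inducedOddCycle G c (convexGeometry⇒noInducedOddCycle G geometry))
  (bipartite⇒convexGeometry G)
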